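{- Let $k\ge2$, $f\in P_k^n$ with $ess(f)=n$, and let $g\preceq f$ be a subfunction with $ess(g)=m<n$. Then there exists a variable $x_t\in Ess(f)\setminus Ess(g)$ such that $Ess(g)\cup\{x_t\}\in Sep(f)$.
   Context: $Z_k=\{0,\dots,k-1\}$; $P_k^n$ is the set of functions $Z_k^n\to Z_k$ in variables $x_1,\dots,x_n$. A variable $x_i$ is essential in $f$ if there are $a_1,\dots,a_n,b\in Z_k$ with $f(a_1,\dots,a_i,\dots,a_n)\neq f(a_1,\dots,a_{i-1},b,a_{i+1},\dots,a_n)$; $Ess(f)$ is the set of essential variables and $ess(f)=|Ess(f)|$. For $x_i\in Ess(f)$ and $c\in Z_k$, $f(x_i=c)$ is the function obtained by replacing $x_i$ by $c$, written $f(x_i=c)\prec f$; $\preceq$ is the reflexive–transitive closure of $\prec$ ($g$ is a subfunction of $f$ if $g\preceq f$). A non-empty $M\subseteq Ess(f)$ is separable in $f$ if $M=Ess(h)$ for some $h\preceq f$; $Sep(f)$ is the set of separable sets of $f$. -}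

module Defs where

open import Data.Nat using (ℕ; zero; suc)
open import Data.Fin using (Fin)
open import Data.Fin.Properties using (any?)
open import Data.Vec using (Vec; []; _∷_; _[_]≔_)
open import Data.List using (List; length; filter)
open import Data.List using () renaming ([] to []ˡ)
open import Data.Fin using () renaming (zero to fz)
open import Data.List.Base using (allFin)
open import Data.Product using (Σ; ∃; _×_; _,_; proj₁; proj₂)
open import Data.Sum using (_⊎_)
open import Relation.Nullary using (Dec; yes; no; ¬_)
open import Relation.Nullary.Decidable using (map′; ¬?)
open import Relation.Binary.PropositionalEquality using (_≡_)
open import Function.Bundles using (_⇔_)
open import Data.Fin using (_≟_)

P : ℕ → ℕ → Set
P k n = Vec (Fin k) n → Fin k

Essential : ∀ {k n} → P k n → Fin n → Set
Essential {k} {n} f i = Σ (Vec (Fin k) n) λ a → Σ (Fin k) λ b → ¬ (f a ≡ f (a [ i ]≔ b))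

subst-var : ∀ {k n} → P k n → Fin n → Fin k → P k n
subst-var f i c a = f (a [ i ]≔ c)

data _≺_ {k n : ℕ} : P k n → P k n → Set where
  step : ∀ {f} (i : Fin n) (c : Fin k) → Essential f i → subst-var f i c ≺ f

data _⪯_ {k n : ℕ} : P k n → P k n → Set where
  ⪯-refl : ∀ {f} → f ⪯ f
  ⪯-step : ∀ {f g h} → h ≺ g → g ⪯ f → h ⪯ f

∃vec? : ∀ {k} n {Q : Vec (Fin k) n → Set} → (∀ v → Dec (Q v)) → Dec (∃ Q)
∃vec? zero Q? = map′ (λ q → [] , q) (λ { ([] , q) → q }) (Q? [])
∃vec? (suc n) {Q} Q? =
  map′ (λ { (x , v , q) → x ∷ v , q }) (λ { (x ∷ v , q) → x , v , q })
       (any? λ x → ∃vec? n λ v → Q? (x ∷ v))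

Essential? : ∀ {k n} (f : P k n) (i : Fin n) → Dec (Essential f i)
Essential? {k} {n} f i = ∃vec? n λ a → any? λ b → ¬? (f a ≟ f (a [ i ]≔ b))

ess : ∀ {k n} → P k n → ℕ
ess {n = n} f = length (filter (Essential? f) (allFin n))

-- M (a set of variables, given as a predicate) is separable in f:
-- M = Ess(h) for some h ⪯ f  (non-emptiness is part of the definition)
Separable : ∀ {k n} → P k n → (Fin n → Set) → Set
Separable {k} {n} f M =
  (∃ λ i → M i) × (∃ λ (h : P k n) → h ⪯ f × (∀ i → Essential h i ⇔ M i))

module Submission where

open import Defs
open import Data.Nat using (ℕ; _≤_; _<_)
open import Data.Nat.Properties using (<-irrefl)
open import Data.Fin using (Fin; _≟_)
open import Data.Vec using (Vec; lookup; _[_]≔_)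
open import Data.Vec.Properties using ([]≔-idempotent; []≔-commutes; []≔-lookup)
open import Data.List using (List; []; _∷_; filter; allFin)
open import Data.List.Membership.Propositional using (_∈_; _∉_)
open import Data.List.Membership.Propositional.Properties using (∈-filter⁺; ∈-filter⁻; ∈-allFin)
open import Data.List.Relation.Unary.Any using (here; there)
open import Data.Product using (∃; _×_; _,_; proj₂)
open import Data.Sum using (_⊎_; inj₁; inj₂)
open import Data.Empty using (⊥-elim)
open import Function using (_∘_)
open import Function.Bundles using (mk⇔)
open import Relation.Nullary using (¬_; Dec; yes; no)
open import Relation.Nullary.Decidable using (¬?; _⊎-dec_; decidable-stable)
open import Relation.Binary.PropositionalEquality
  using (_≡_; _≢_; _≗_; refl; sym; trans; cong; module ≡-Reasoning)

-- Write g = F(x_s = c) with F ⪯ f and x_s essential in F (g ≠ f, as ess g < ess f),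
-- and pick a, b with F(a) ≠ F(a[s ≔ b]).  Fixing every variable outside
-- Ess(g) ∪ {x_s} to its value in a yields a subfunction h of F.  The fixed
-- variables are inessential in g, so h(x_s = c) = g and Ess(g) ⊆ Ess(h); the pair
-- a, a[s ≔ b] is untouched by the fixing, so x_s stays essential; and a fixed
-- variable cannot be essential in h.  Hence Ess(h) = Ess(g) ∪ {x_s}.

private
  variable
    k n : ℕ
    F G H : P k n
    i j s : Fin n
    c : Fin k

Essential-resp-≗ : G ≗ H → Essential G i → Essential H i
Essential-resp-≗ G≗H (x , b , d) = x , b , λ q → d (trans (G≗H x) (trans q (sym (G≗H _))))

¬Essential⇒invariant : ¬ Essential G j → ∀ x v → G x ≡ G (x [ j ]≔ v)
¬Essential⇒invariant {G = G} {j} ¬ess x v =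
  decidable-stable (G x ≟ G (x [ j ]≔ v)) (λ d → ¬ess (x , v , d))

¬Essential-subst-var : ∀ F s c → ¬ Essential {k} {n} (subst-var F s c) s
¬Essential-subst-var F s c (x , _ , d) = d (cong F (sym ([]≔-idempotent x s)))

Essential-subst-var⇒Essential : ∀ F j c → Essential (subst-var F j c) i → Essential {k} {n} F i
Essential-subst-var⇒Essential {i = i} F j c ess@(x , b , d) with i ≟ j
... | yes refl = ⊥-elim (¬Essential-subst-var F j c ess)
... | no i≢j = x [ j ]≔ c , b , λ q → d (trans q (cong F (sym ([]≔-commutes x i j i≢j))))

⪯-trans : H ⪯ G → G ⪯ F → H ⪯ F
⪯-trans ⪯-refl G⪯F = G⪯F
⪯-trans (⪯-step H≺ ⪯G) G⪯F = ⪯-step H≺ (⪯-trans ⪯G G⪯F)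

Essential-⪯ : G ⪯ F → Essential G i → Essential F i
Essential-⪯ ⪯-refl ess = ess
Essential-⪯ (⪯-step (step j c _) G⪯F) ess = Essential-⪯ G⪯F (Essential-subst-var⇒Essential _ j c ess)

Separable-⪯ : {M : Fin n → Set} → G ⪯ F → Separable G M → Separable F M
Separable-⪯ G⪯F (nonempty , h , h⪯G , ess⇔M) = nonempty , h , ⪯-trans h⪯G G⪯F , ess⇔M

fixOn : List (Fin n) → Vec (Fin k) n → Vec (Fin k) n → Vec (Fin k) n
fixOn []      a x = x
fixOn (j ∷ L) a x = fixOn L a (x [ j ]≔ lookup a j)

fixOn-self : ∀ L (a : Vec (Fin k) n) → fixOn L a a ≡ a
fixOn-self []      a = refl
fixOn-self (j ∷ L) a = trans (cong (fixOn L a) ([]≔-lookup a j)) (fixOn-self L a)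

fixOn-[]≔-∉ : ∀ L a x {v} → s ∉ L → fixOn {n} {k} L a (x [ s ]≔ v) ≡ fixOn L a x [ s ]≔ v
fixOn-[]≔-∉         []      a x s∉L = refl
fixOn-[]≔-∉ {s = s} (j ∷ L) a x {v} s∉L = begin
  fixOn L a ((x [ s ]≔ v) [ j ]≔ lookup a j)  ≡⟨ cong (fixOn L a) ([]≔-commutes x s j (s∉L ∘ here)) ⟩
  fixOn L a ((x [ j ]≔ lookup a j) [ s ]≔ v)  ≡⟨ fixOn-[]≔-∉ L a _ (s∉L ∘ there) ⟩
  fixOn L a (x [ j ]≔ lookup a j) [ s ]≔ v    ∎
  where open ≡-Reasoning

fixOn-[]≔-∈ : ∀ L a x {v} → i ∈ L → fixOn {n} {k} L a (x [ i ]≔ v) ≡ fixOn L a x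
fixOn-[]≔-∈ {i = i} (j ∷ L) a x (here refl) = cong (fixOn L a) ([]≔-idempotent x i)
fixOn-[]≔-∈ {i = i} (j ∷ L) a x (there i∈L) with i ≟ j
... | yes refl = cong (fixOn L a) ([]≔-idempotent x i)
... | no i≢j = trans (cong (fixOn L a) ([]≔-commutes x i j i≢j)) (fixOn-[]≔-∈ L a _ i∈L)

invariant-fixOn : ∀ L a → (∀ {j} → j ∈ L → ¬ Essential G j) → ∀ x → G (fixOn L a x) ≡ G x
invariant-fixOn []      a ¬ess x = refl
invariant-fixOn (j ∷ L) a ¬ess x =
  trans (invariant-fixOn L a (¬ess ∘ there) _) (sym (¬Essential⇒invariant (¬ess (here refl)) x _))

fixOn-subfunction : ∀ L a (F : P k n) → ∃ λ h → h ⪯ F × h ≗ F ∘ fixOn L a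
fixOn-subfunction []      a F = F , ⪯-refl , λ _ → refl
fixOn-subfunction (j ∷ L) a F with fixOn-subfunction L a F
... | h , h⪯F , h≗ with Essential? h j
...   | yes ess = subst-var h j (lookup a j) , ⪯-step (step j _ ess) h⪯F , h≗ ∘ (_[ j ]≔ lookup a j)
...   | no ¬ess = h , h⪯F , λ x → trans (¬Essential⇒invariant ¬ess x _) (h≗ _)

Essential-∘fixOn⇒∉ : ∀ (F : P k n) L a → Essential (F ∘ fixOn L a) i → i ∉ L
Essential-∘fixOn⇒∉ F L a (x , b , d) i∈L = d (cong F (sym (fixOn-[]≔-∈ L a x i∈L)))

Essential-∘fixOn-witness : ∀ (F : P k n) L a → F a ≢ F (a [ s ]≔ c) → s ∉ L →
                           Essential (F ∘ fixOn L a) s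
Essential-∘fixOn-witness {s = s} {c = c} F L a d s∉L = a , c , λ q → d (begin
  F a                             ≡⟨ cong F (sym (fixOn-self L a)) ⟩
  F (fixOn L a a)                 ≡⟨ q ⟩
  F (fixOn L a (a [ s ]≔ c))      ≡⟨ cong F (fixOn-[]≔-∉ L a a s∉L) ⟩
  F (fixOn L a a [ s ]≔ c)        ≡⟨ cong (λ y → F (y [ s ]≔ c)) (fixOn-self L a) ⟩
  F (a [ s ]≔ c)                  ∎)
  where open ≡-Reasoning

subst-var-∘fixOn : ∀ F c L a → s ∉ L → (∀ {j} → j ∈ L → ¬ Essential (subst-var F s c) j) →
                   subst-var (F ∘ fixOn L a) s c ≗ subst-var {k} {n} F s c
subst-var-∘fixOn F c L a s∉L ¬ess x =
  trans (cong F (fixOn-[]≔-∉ L a x s∉L)) (invariant-fixOn L a ¬ess x)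

separable-subst-var∪ : ∀ {k n} {F : P k n} {s c} → Essential F s →
                       Separable F (λ i → Essential (subst-var F s c) i ⊎ i ≡ s)
separable-subst-var∪ {n = n} {F} {s} {c} (a , b , d) =
  let h , h⪯F , h≗ = fixOn-subfunction Fixed a F in
  (s , inj₂ refl) , h , h⪯F ,
  λ i → mk⇔ (sound i ∘ Essential-resp-≗ h≗) (Essential-resp-≗ (sym ∘ h≗) ∘ complete)
  where
  Kept : Fin n → Set
  Kept i = Essential (subst-var F s c) i ⊎ i ≡ s

  kept? : ∀ i → Dec (Kept i)
  kept? i = Essential? (subst-var F s c) i ⊎-dec (i ≟ s)

  Fixed : List (Fin n)
  Fixed = filter (¬? ∘ kept?) (allFin n)

  fixed⇒¬kept : j ∈ Fixed → ¬ Kept j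
  fixed⇒¬kept = proj₂ ∘ ∈-filter⁻ (¬? ∘ kept?) {xs = allFin n}

  s∉Fixed : s ∉ Fixed
  s∉Fixed s∈ = fixed⇒¬kept s∈ (inj₂ refl)

  sound : ∀ i → Essential (F ∘ fixOn Fixed a) i → Kept i
  sound i ess = decidable-stable (kept? i)
    (Essential-∘fixOn⇒∉ F Fixed a ess ∘ ∈-filter⁺ (¬? ∘ kept?) (∈-allFin i))

  complete : ∀ {i} → Kept i → Essential (F ∘ fixOn Fixed a) i
  complete (inj₁ ess) = Essential-subst-var⇒Essential (F ∘ fixOn Fixed a) s c
    (Essential-resp-≗ (sym ∘ subst-var-∘fixOn F c Fixed a s∉Fixed (λ j∈ ess → fixed⇒¬kept j∈ (inj₁ ess))) ess)
  complete (inj₂ refl) = Essential-∘fixOn-witness F Fixed a d s∉Fixed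

lemma3p2 : (k n m : ℕ) → 2 ≤ k → (f g : P k n) → ess f ≡ n → g ⪯ f →
    ess g ≡ m → m < n →
    ∃ λ (t : Fin n) → Essential f t × ¬ Essential g t ×
    Separable f (λ i → Essential g i ⊎ i ≡ t)
lemma3p2 k n m _ f _ ess-f ⪯-refl ess-g m<n = ⊥-elim (<-irrefl (trans (sym ess-g) ess-f) m<n)
lemma3p2 k n m _ f _ ess-f (⪯-step (step {F} s c s∈EssF) F⪯f) ess-g m<n =
  s , Essential-⪯ F⪯f s∈EssF , ¬Essential-subst-var F s c ,
  Separable-⪯ F⪯f (separable-subst-var∪ s∈EssF)
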